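{- For a positive integer $n$, let \[ g(n):=\sum_{\vec w\in\mathrm{Part}(n)}(-2)^{\#\vec w}\,\Big(\prod_{l=1}^{\#\vec w}(\#w_l)!\Big)\,(\#\vec w-1)!. \] Then $g(n)=-2(n-1)!$ if $n$ is odd and $g(n)=0$ if $n$ is even.
   Context: $\mathrm{Part}(n)$ is the set of set partitions $\vec w=\{w_1,\ldots,w_t\}$ of $\{1,\ldots,n\}$ into nonempty parts; $\#\vec w=t$ is the number of parts and $\#w_l$ is the cardinality of the part $w_l$. -}

module Defs where

open import Data.Nat as ℕ using (ℕ; zero; suc; _∸_; _!)
open import Data.Nat.ListAction using (product)
open import Data.Fin using (Fin; fromℕ; inject₁)
open import Data.List using (List; []; _∷_; map; concatMap; length; foldr)
open import Data.Integer as ℤ using (ℤ; +_; -[1+_])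

-- A set partition of {0,…,n-1} (i.e. of {1,…,n} shifted) is represented as a list
-- of its blocks, each block a list of elements.
Block : ℕ → Set
Block n = List (Fin n)

SetPartition : ℕ → Set
SetPartition n = List (Block n)

private
  liftBlock : ∀ {n} → Block n → Block (suc n)
  liftBlock = map inject₁

  insertions : ∀ {n} → Fin (suc n) → List (Block (suc n)) → List (SetPartition (suc n))
  insertions x [] = []
  insertions x (b ∷ bs) = ((x ∷ b) ∷ bs) ∷ map (b ∷_) (insertions x bs)

-- Part n : the list of all set partitions of an n-element set, each exactly once,
-- generated by the standard recursion: a partition of {0,…,n} arises from a
-- unique partition of {0,…,n-1} either by adding the singleton {n} as a new block
-- or by adding n to exactly one existing block.
Part : (n : ℕ) → List (SetPartition n)
Part zero = [] ∷ []
Part (suc n) = concatMap extend (Part n)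
  where
    extend : SetPartition n → List (SetPartition (suc n))
    extend p = ((fromℕ n ∷ []) ∷ ps) ∷ insertions (fromℕ n) ps
      where ps = map liftBlock p

#parts : ∀ {n} → SetPartition n → ℕ
#parts = length

term : ∀ {n} → SetPartition n → ℤ
term w = (ℤ.- (+ 2)) ℤ.^ #parts w
         ℤ.* (+ product (map (λ b → (length b) !) w))
         ℤ.* (+ ((#parts w ∸ 1) !))

g : ℕ → ℤ
g n = foldr ℤ._+_ (+ 0) (map term (Part n))

{-# OPTIONS --safe #-}
-- Only the block sizes of a partition enter its summand. Adding a new element to a
-- partition of {1,…,n} with t blocks either opens a new block or enlarges one block, and
-- enlarging a block of size s multiplies its weight s! by s+1; summing over all blocks gives
-- the factor n+t. Hence L(n,t) = Σ_{#w=t} ∏ (#w_l)! obeys the Lah recurrence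
-- L(n+1,t) = L(n,t-1) + (n+t) L(n,t), so that L(n+1,t) (t-1)! = n! C(n+1,t) and
-- g(n+1) = n! Σ_{t≥1} C(n+1,t) (-2)^t = n! ((-1)^(n+1) - 1) by the binomial theorem.
module Submission where

open import Defs
open import Data.Nat using (ℕ; suc; _*_; _+_; _!)
open import Data.Integer using (ℤ; +_; -_)
open import Data.Product using (_×_)
open import Relation.Binary.PropositionalEquality using (_≡_)

open import Data.Nat using (zero; _∸_)
open import Data.Nat.ListAction using (sum; product)
import Data.Nat.Properties as ℕ
import Data.Nat.Tactic.RingSolver as ℕ-Solver
import Data.Integer as ℤ
open import Data.Integer.Properties using (+-identityˡ; +-identityʳ; +-assoc; *-identityʳ; *-zeroʳ; *-distribˡ-+; *-distribʳ-+; *-comm; neg-distribˡ-*; pos-+; pos-*; ^-*-assoc; ^-zeroˡ)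
open import Data.Integer.Tactic.RingSolver using (solve-∀)
open import Data.Fin using (fromℕ; inject₁)
open import Data.List using (List; []; _∷_; map; concatMap; length; foldr; drop; _++_)
open import Data.List.Properties using (map-∘; map-cong; map-cong-local; length-map; drop-map; map-concatMap; concatMap-map; concatMap-cong; map-++)
open import Data.List.Relation.Unary.All as All using (All; []; _∷_)
open import Data.List.Relation.Unary.All.Properties using (map⁺; concat⁺)
open import Data.Product using (_,_)
open import Function using (_∘_)
open import Relation.Binary.PropositionalEquality using (refl; sym; trans; cong; cong₂; subst; module ≡-Reasoning)

sizes : ∀ {n} → SetPartition n → List ℕ
sizes = map length

blockSizes : ℕ → List (List ℕ)
blockSizes n = map sizes (Part n)

increments : List ℕ → List (List ℕ)
increments []      = []
increments (x ∷ s) = (suc x ∷ s) ∷ map (x ∷_) (increments s)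

extendSizes : List ℕ → List (List ℕ)
extendSizes s = (1 ∷ s) ∷ increments s

sizes-lift : ∀ {n} (p : SetPartition n) → sizes (map (map inject₁) p) ≡ sizes p
sizes-lift []      = refl
sizes-lift (b ∷ p) = cong₂ _∷_ (length-map inject₁ b) (sizes-lift p)

-- Part (suc n) unfolds to concatMap of a function local to Defs, so it is characterised
-- by its unfolding; the insertions of the new element into the blocks of p are drop 1 (extend p).
module _ {n : ℕ} (extend : SetPartition n → List (SetPartition (suc n)))
  (extend-[] : extend [] ≡ ((fromℕ n ∷ []) ∷ []) ∷ [])
  (extend-∷ : ∀ b p → extend (b ∷ p) ≡
      ((fromℕ n ∷ []) ∷ map inject₁ b ∷ map (map inject₁) p)
    ∷ ((fromℕ n ∷ map inject₁ b) ∷ map (map inject₁) p)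
    ∷ map (map inject₁ b ∷_) (drop 1 (extend p)))
  where

  sizes-extend : ∀ p → map sizes (extend p) ≡ extendSizes (sizes p)
  sizes-extend [] rewrite extend-[] = refl
  sizes-extend (b ∷ p) rewrite extend-∷ b p | length-map inject₁ b | sizes-lift p =
    cong (λ ss → (1 ∷ length b ∷ sizes p) ∷ (suc (length b) ∷ sizes p) ∷ ss) (begin
      map sizes (map (map inject₁ b ∷_) (drop 1 (extend p)))
        ≡⟨ sym (map-∘ (drop 1 (extend p))) ⟩
      map (sizes ∘ (map inject₁ b ∷_)) (drop 1 (extend p))
        ≡⟨ map-cong (λ w → cong (_∷ sizes w) (length-map inject₁ b)) (drop 1 (extend p)) ⟩
      map ((length b ∷_) ∘ sizes) (drop 1 (extend p))
        ≡⟨ map-∘ (drop 1 (extend p)) ⟩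
      map (length b ∷_) (map sizes (drop 1 (extend p)))
        ≡⟨ cong (map (length b ∷_)) (trans (sym (drop-map 1 (extend p))) (cong (drop 1) (sizes-extend p))) ⟩
      map (length b ∷_) (increments (sizes p))
        ∎)
    where open ≡-Reasoning

  sizes-concatMap-extend : ∀ ps → map sizes (concatMap extend ps) ≡ concatMap extendSizes (map sizes ps)
  sizes-concatMap-extend ps = begin
    map sizes (concatMap extend ps)         ≡⟨ map-concatMap sizes extend ps ⟩
    concatMap (map sizes ∘ extend) ps       ≡⟨ concatMap-cong sizes-extend ps ⟩
    concatMap (extendSizes ∘ sizes) ps      ≡⟨ concatMap-map extendSizes sizes ps ⟨
    concatMap extendSizes (map sizes ps)    ∎
    where open ≡-Reasoning

blockSizes-suc : ∀ n → blockSizes (suc n) ≡ concatMap extendSizes (blockSizes n)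
blockSizes-suc n = sizes-concatMap-extend _ refl (λ _ _ → refl) (Part n)

increments-length : ∀ s → All (λ s′ → length s′ ≡ length s) (increments s)
increments-length []      = []
increments-length (x ∷ s) = refl ∷ map⁺ (All.map (cong suc) (increments-length s))

increments-sum : ∀ s → All (λ s′ → sum s′ ≡ suc (sum s)) (increments s)
increments-sum []      = []
increments-sum (x ∷ s) =
  refl ∷ map⁺ (All.map (λ e → trans (cong (λ m → x + m) e) (ℕ.+-suc x (sum s))) (increments-sum s))

extendSizes-sum : ∀ {n s} → sum s ≡ n → All (λ s′ → sum s′ ≡ suc n) (extendSizes s)
extendSizes-sum {s = s} refl = refl ∷ increments-sum s

blockSizes-sum : ∀ n → All (λ s → sum s ≡ n) (blockSizes n)
blockSizes-sum zero    = refl ∷ []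
blockSizes-sum (suc n) = subst (All _) (sym (blockSizes-suc n))
  (concat⁺ (map⁺ (All.map extendSizes-sum (blockSizes-sum n))))

factorialProduct : List ℕ → ℕ
factorialProduct s = product (map _! s)

sum-factorialProduct-∷ : ∀ x L →
  sum (map factorialProduct (map (x ∷_) L)) ≡ x ! * sum (map factorialProduct L)
sum-factorialProduct-∷ x []      = sym (ℕ.*-zeroʳ (x !))
sum-factorialProduct-∷ x (s ∷ L) =
  trans (cong (λ m → x ! * factorialProduct s + m) (sum-factorialProduct-∷ x L))
        (sym (ℕ.*-distribˡ-+ (x !) (factorialProduct s) _))

-- Enlarging the i-th block multiplies s_i! by s_i + 1, and Σ_i (s_i + 1) = sum s + length s.
sum-factorialProduct-increments : ∀ s →
  sum (map factorialProduct (increments s)) ≡ factorialProduct s * (sum s + length s)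
sum-factorialProduct-increments []      = refl
sum-factorialProduct-increments (x ∷ s) = begin
  suc x ! * w + sum (map factorialProduct (map (x ∷_) (increments s)))
    ≡⟨ cong (λ m → suc x ! * w + m) (sum-factorialProduct-∷ x (increments s)) ⟩
  suc x * x ! * w + x ! * sum (map factorialProduct (increments s))
    ≡⟨ cong (λ m → suc x * x ! * w + x ! * m) (sum-factorialProduct-increments s) ⟩
  suc x * x ! * w + x ! * (w * (sum s + length s))
    ≡⟨ regroup (x !) x w (sum s) (length s) ⟩
  x ! * w * ((x + sum s) + suc (length s))
    ∎
  where
  open ≡-Reasoning
  w = factorialProduct s
  regroup : ∀ f x w S L → suc x * f * w + f * (w * (S + L)) ≡ f * w * ((x + S) + suc L)
  regroup = ℕ-Solver.solve-∀

sumℤ : List ℤ → ℤ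
sumℤ = foldr ℤ._+_ (+ 0)

sumℤ-++ : ∀ xs ys → sumℤ (xs ++ ys) ≡ sumℤ xs ℤ.+ sumℤ ys
sumℤ-++ []       ys = sym (+-identityˡ (sumℤ ys))
sumℤ-++ (x ∷ xs) ys = trans (cong (λ i → x ℤ.+ i) (sumℤ-++ xs ys)) (sym (+-assoc x _ _))

sumℤ-concatMap : ∀ {A B : Set} (f : B → ℤ) (h : A → List B) xs →
  sumℤ (map f (concatMap h xs)) ≡ sumℤ (map (sumℤ ∘ map f ∘ h) xs)
sumℤ-concatMap f h []       = refl
sumℤ-concatMap f h (x ∷ xs) = begin
  sumℤ (map f (h x ++ concatMap h xs))
    ≡⟨ cong sumℤ (map-++ f (h x) (concatMap h xs)) ⟩
  sumℤ (map f (h x) ++ map f (concatMap h xs))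
    ≡⟨ sumℤ-++ (map f (h x)) _ ⟩
  sumℤ (map f (h x)) ℤ.+ sumℤ (map f (concatMap h xs))
    ≡⟨ cong (λ i → sumℤ (map f (h x)) ℤ.+ i) (sumℤ-concatMap f h xs) ⟩
  sumℤ (map f (h x)) ℤ.+ sumℤ (map (sumℤ ∘ map f ∘ h) xs)
    ∎
  where open ≡-Reasoning

weight : (ℕ → ℤ) → List ℕ → ℤ
weight c s = c (length s) ℤ.* + factorialProduct s

sumℤ-weight-sameLength : ∀ c ℓ L → All (λ s → length s ≡ ℓ) L →
  sumℤ (map (weight c) L) ≡ c ℓ ℤ.* + sum (map factorialProduct L)
sumℤ-weight-sameLength c ℓ []      []         = sym (*-zeroʳ (c ℓ))
sumℤ-weight-sameLength c ℓ (s ∷ L) (refl ∷ es) = begin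
  c ℓ ℤ.* + factorialProduct s ℤ.+ sumℤ (map (weight c) L)
    ≡⟨ cong (λ i → c ℓ ℤ.* + factorialProduct s ℤ.+ i) (sumℤ-weight-sameLength c ℓ L es) ⟩
  c ℓ ℤ.* + factorialProduct s ℤ.+ c ℓ ℤ.* + sum (map factorialProduct L)
    ≡⟨ *-distribˡ-+ (c ℓ) (+ factorialProduct s) _ ⟨
  c ℓ ℤ.* (+ factorialProduct s ℤ.+ + sum (map factorialProduct L))
    ≡⟨ cong (c ℓ ℤ.*_) (pos-+ (factorialProduct s) _) ⟨
  c ℓ ℤ.* + (factorialProduct s + sum (map factorialProduct L))
    ∎
  where open ≡-Reasoning

-- lahSum n c = Σ_t L(n,t) c(t), where L are the Lah numbers: the recurrence
-- L(n+1,t) = L(n,t-1) + (n+t) L(n,t) is applied to the coefficients c instead.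
lahStep : ℕ → (ℕ → ℤ) → ℕ → ℤ
lahStep n c t = c (suc t) ℤ.+ + (n + t) ℤ.* c t

lahSum : ℕ → (ℕ → ℤ) → ℤ
lahSum zero    c = c 0
lahSum (suc n) c = lahSum n (lahStep n c)

sumℤ-weight-extendSizes : ∀ {n} c {s} → sum s ≡ n →
  sumℤ (map (weight c) (extendSizes s)) ≡ weight (lahStep n c) s
sumℤ-weight-extendSizes c {s} refl = begin
  c (suc ℓ) ℤ.* + (1 * w) ℤ.+ sumℤ (map (weight c) (increments s))
    ≡⟨ cong₂ ℤ._+_ (cong (λ m → c (suc ℓ) ℤ.* + m) (ℕ.*-identityˡ w))
                   (sumℤ-weight-sameLength c ℓ (increments s) (increments-length s)) ⟩
  c (suc ℓ) ℤ.* + w ℤ.+ c ℓ ℤ.* + sum (map factorialProduct (increments s))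
    ≡⟨ cong (λ m → c (suc ℓ) ℤ.* + w ℤ.+ c ℓ ℤ.* + m) (sum-factorialProduct-increments s) ⟩
  c (suc ℓ) ℤ.* + w ℤ.+ c ℓ ℤ.* + (w * (sum s + ℓ))
    ≡⟨ cong (λ i → c (suc ℓ) ℤ.* + w ℤ.+ c ℓ ℤ.* i) (pos-* w (sum s + ℓ)) ⟩
  c (suc ℓ) ℤ.* + w ℤ.+ c ℓ ℤ.* (+ w ℤ.* + (sum s + ℓ))
    ≡⟨ factor (c (suc ℓ)) (c ℓ) (+ w) (+ (sum s + ℓ)) ⟩
  (c (suc ℓ) ℤ.+ + (sum s + ℓ) ℤ.* c ℓ) ℤ.* + w
    ∎
  where
  open ≡-Reasoning
  ℓ = length s
  w = factorialProduct s
  factor : ∀ a b w m → a ℤ.* w ℤ.+ b ℤ.* (w ℤ.* m) ≡ (a ℤ.+ m ℤ.* b) ℤ.* w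
  factor = solve-∀

sumℤ-weight-blockSizes : ∀ n c → sumℤ (map (weight c) (blockSizes n)) ≡ lahSum n c
sumℤ-weight-blockSizes zero    c = trans (+-identityʳ _) (*-identityʳ (c 0))
sumℤ-weight-blockSizes (suc n) c = begin
  sumℤ (map (weight c) (blockSizes (suc n)))
    ≡⟨ cong (sumℤ ∘ map (weight c)) (blockSizes-suc n) ⟩
  sumℤ (map (weight c) (concatMap extendSizes (blockSizes n)))
    ≡⟨ sumℤ-concatMap (weight c) extendSizes (blockSizes n) ⟩
  sumℤ (map (sumℤ ∘ map (weight c) ∘ extendSizes) (blockSizes n))
    ≡⟨ cong sumℤ (map-cong-local (All.map (λ {s} → sumℤ-weight-extendSizes c {s}) (blockSizes-sum n))) ⟩
  sumℤ (map (weight (lahStep n c)) (blockSizes n))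
    ≡⟨ sumℤ-weight-blockSizes n (lahStep n c) ⟩
  lahSum (suc n) c
    ∎
  where open ≡-Reasoning

-- binomialSum n d = Σ_k C(n,k) d(k), unfolded along Pascal's rule.
binomialSum : ℕ → (ℕ → ℤ) → ℤ
binomialSum zero    d = d 0
binomialSum (suc n) d = binomialSum n (λ t → d t ℤ.+ d (suc t))

binomialSum-cong : ∀ n {d e : ℕ → ℤ} → (∀ t → d t ≡ e t) → binomialSum n d ≡ binomialSum n e
binomialSum-cong zero    d≗e = d≗e 0
binomialSum-cong (suc n) d≗e = binomialSum-cong n (λ t → cong₂ ℤ._+_ (d≗e t) (d≗e (suc t)))

binomialSum-+ : ∀ n (d e : ℕ → ℤ) →
  binomialSum n (λ t → d t ℤ.+ e t) ≡ binomialSum n d ℤ.+ binomialSum n e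
binomialSum-+ zero    d e = refl
binomialSum-+ (suc n) d e =
  trans (binomialSum-cong n (λ t → swap (d t) (e t) (d (suc t)) (e (suc t))))
        (binomialSum-+ n (λ t → d t ℤ.+ d (suc t)) (λ t → e t ℤ.+ e (suc t)))
  where
  swap : ∀ a b a′ b′ → (a ℤ.+ b) ℤ.+ (a′ ℤ.+ b′) ≡ (a ℤ.+ a′) ℤ.+ (b ℤ.+ b′)
  swap = solve-∀

binomialSum-* : ∀ n k (d : ℕ → ℤ) → binomialSum n (λ t → k ℤ.* d t) ≡ k ℤ.* binomialSum n d
binomialSum-* zero    k d = refl
binomialSum-* (suc n) k d =
  trans (binomialSum-cong n (λ t → sym (*-distribˡ-+ k (d t) (d (suc t)))))
        (binomialSum-* n k (λ t → d t ℤ.+ d (suc t)))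

binomialSum-pow : ∀ n y → binomialSum n (y ℤ.^_) ≡ (+ 1 ℤ.+ y) ℤ.^ n
binomialSum-pow zero    y = refl
binomialSum-pow (suc n) y =
  trans (binomialSum-cong n (λ t → factor y (y ℤ.^ t)))
        (trans (binomialSum-* n (+ 1 ℤ.+ y) (y ℤ.^_))
               (cong ((+ 1 ℤ.+ y) ℤ.*_) (binomialSum-pow n y)))
  where
  factor : ∀ y p → p ℤ.+ y ℤ.* p ≡ (+ 1 ℤ.+ y) ℤ.* p
  factor = solve-∀

binomialSum-absorption : ∀ n (e : ℕ → ℤ) →
  binomialSum (suc n) (λ t → + t ℤ.* e t) ≡ + suc n ℤ.* binomialSum n (e ∘ suc)
binomialSum-absorption zero    e = cancel (e 0) (e 1)
  where
  cancel : ∀ a b → + 0 ℤ.* a ℤ.+ + 1 ℤ.* b ≡ + 1 ℤ.* b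
  cancel = solve-∀
binomialSum-absorption (suc n) e = begin
  binomialSum (suc n) (λ t → + t ℤ.* e t ℤ.+ + suc t ℤ.* e (suc t))
    ≡⟨ binomialSum-cong (suc n) (λ t → trans (cong (λ i → + t ℤ.* e t ℤ.+ i ℤ.* e (suc t)) (pos-+ 1 t))
                                             (regroup (+ t) (e t) (e (suc t)))) ⟩
  binomialSum (suc n) (λ t → + t ℤ.* (e t ℤ.+ e (suc t)) ℤ.+ e (suc t))
    ≡⟨ binomialSum-+ (suc n) (λ t → + t ℤ.* (e t ℤ.+ e (suc t))) (e ∘ suc) ⟩
  binomialSum (suc n) (λ t → + t ℤ.* (e t ℤ.+ e (suc t))) ℤ.+ X
    ≡⟨ cong (ℤ._+ X) (binomialSum-absorption n (λ t → e t ℤ.+ e (suc t))) ⟩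
  + suc n ℤ.* X ℤ.+ X
    ≡⟨ succ (+ suc n) X ⟩
  (+ 1 ℤ.+ + suc n) ℤ.* X
    ∎
  where
  open ≡-Reasoning
  X = binomialSum (suc n) (e ∘ suc)
  regroup : ∀ x a b → x ℤ.* a ℤ.+ (+ 1 ℤ.+ x) ℤ.* b ≡ x ℤ.* (a ℤ.+ b) ℤ.+ b
  regroup = solve-∀
  succ : ∀ m X → m ℤ.* X ℤ.+ X ≡ (+ 1 ℤ.+ m) ℤ.* X
  succ = solve-∀

binomialSum-lahStep : ∀ m (d : ℕ → ℤ) →
  binomialSum m (λ t → + t ℤ.* d (suc t) ℤ.+ + (m + t) ℤ.* d t) ≡ + m ℤ.* binomialSum (suc m) d
binomialSum-lahStep zero    d = vanish (d 0) (d 1)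
  where
  vanish : ∀ a b → + 0 ℤ.* b ℤ.+ + 0 ℤ.* a ≡ + 0 ℤ.* (a ℤ.+ b)
  vanish = solve-∀
binomialSum-lahStep (suc n) d = begin
  binomialSum (suc n) (λ t → + t ℤ.* d (suc t) ℤ.+ + (suc n + t) ℤ.* d t)
    ≡⟨ binomialSum-cong (suc n) (λ t → cong (λ i → + t ℤ.* d (suc t) ℤ.+ i)
         (trans (cong (ℤ._* d t) (pos-+ (suc n) t)) (*-distribʳ-+ (d t) (+ suc n) (+ t)))) ⟩
  binomialSum (suc n) (λ t → + t ℤ.* d (suc t) ℤ.+ (+ suc n ℤ.* d t ℤ.+ + t ℤ.* d t))
    ≡⟨ binomialSum-+ (suc n) (λ t → + t ℤ.* d (suc t)) (λ t → + suc n ℤ.* d t ℤ.+ + t ℤ.* d t) ⟩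
  binomialSum (suc n) (λ t → + t ℤ.* d (suc t))
    ℤ.+ binomialSum (suc n) (λ t → + suc n ℤ.* d t ℤ.+ + t ℤ.* d t)
    ≡⟨ cong₂ ℤ._+_ (binomialSum-absorption n (d ∘ suc))
         (trans (binomialSum-+ (suc n) (λ t → + suc n ℤ.* d t) (λ t → + t ℤ.* d t))
                (cong₂ ℤ._+_ (binomialSum-* (suc n) (+ suc n) d) (binomialSum-absorption n d))) ⟩
  + suc n ℤ.* Z ℤ.+ (+ suc n ℤ.* X ℤ.+ + suc n ℤ.* Y)
    ≡⟨ collect (+ suc n) X Y Z ⟩
  + suc n ℤ.* (X ℤ.+ (Y ℤ.+ Z))
    ≡⟨ cong (λ i → + suc n ℤ.* (X ℤ.+ i)) (binomialSum-+ n (d ∘ suc) (d ∘ suc ∘ suc)) ⟨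
  + suc n ℤ.* (X ℤ.+ binomialSum (suc n) (d ∘ suc))
    ≡⟨ cong (+ suc n ℤ.*_) (binomialSum-+ (suc n) d (d ∘ suc)) ⟨
  + suc n ℤ.* binomialSum (suc (suc n)) d
    ∎
  where
  open ≡-Reasoning
  X = binomialSum (suc n) d
  Y = binomialSum n (d ∘ suc)
  Z = binomialSum n (d ∘ suc ∘ suc)
  collect : ∀ m x y z → m ℤ.* z ℤ.+ (m ℤ.* x ℤ.+ m ℤ.* y) ≡ m ℤ.* (x ℤ.+ (y ℤ.+ z))
  collect = solve-∀

-- L(n+1,t) (t-1)! = n! C(n+1,t); c 0 is irrelevant since L(n+1,0) = 0.
lahSum-binomialSum : ∀ n (d c : ℕ → ℤ) → (∀ t → c (suc t) ≡ d (suc t) ℤ.* + (t !)) →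
  lahSum (suc n) c ≡ + (n !) ℤ.* (binomialSum (suc n) d ℤ.- d 0)
lahSum-binomialSum zero d c c≡ = trans (cong (ℤ._+ + 0 ℤ.* c 0) (c≡ 0)) (cancel (d 0) (d 1) (c 0))
  where
  cancel : ∀ a b z → b ℤ.* + 1 ℤ.+ + 0 ℤ.* z ≡ + 1 ℤ.* ((a ℤ.+ b) ℤ.- a)
  cancel = solve-∀
lahSum-binomialSum (suc n) d c c≡ = begin
  lahSum (suc n) (lahStep (suc n) c)
    ≡⟨ lahSum-binomialSum n d′ (lahStep (suc n) c) step ⟩
  + (n !) ℤ.* (binomialSum (suc n) d′ ℤ.- d′ 0)
    ≡⟨ cong (λ i → + (n !) ℤ.* (i ℤ.- d′ 0)) (binomialSum-lahStep (suc n) d) ⟩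
  + (n !) ℤ.* (+ suc n ℤ.* B ℤ.- (+ 0 ℤ.* d 1 ℤ.+ + (suc n + 0) ℤ.* d 0))
    ≡⟨ cong (λ m → + (n !) ℤ.* (+ suc n ℤ.* B ℤ.- (+ 0 ℤ.* d 1 ℤ.+ + m ℤ.* d 0))) (ℕ.+-identityʳ (suc n)) ⟩
  + (n !) ℤ.* (+ suc n ℤ.* B ℤ.- (+ 0 ℤ.* d 1 ℤ.+ + suc n ℤ.* d 0))
    ≡⟨ factor (+ (n !)) (+ suc n) B (d 0) (d 1) ⟩
  (+ suc n ℤ.* + (n !)) ℤ.* (B ℤ.- d 0)
    ≡⟨ cong (ℤ._* (B ℤ.- d 0)) (pos-* (suc n) (n !)) ⟨
  + (suc n !) ℤ.* (B ℤ.- d 0)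
    ∎
  where
  open ≡-Reasoning
  B = binomialSum (suc (suc n)) d
  d′ : ℕ → ℤ
  d′ t = + t ℤ.* d (suc t) ℤ.+ + (suc n + t) ℤ.* d t
  step : ∀ t → lahStep (suc n) c (suc t) ≡ d′ (suc t) ℤ.* + (t !)
  step t = begin
    c (suc (suc t)) ℤ.+ + m ℤ.* c (suc t)
      ≡⟨ cong₂ (λ i j → i ℤ.+ + m ℤ.* j) (c≡ (suc t)) (c≡ t) ⟩
    d (suc (suc t)) ℤ.* + (suc t * t !) ℤ.+ + m ℤ.* (d (suc t) ℤ.* + (t !))
      ≡⟨ cong (λ i → d (suc (suc t)) ℤ.* i ℤ.+ + m ℤ.* (d (suc t) ℤ.* + (t !))) (pos-* (suc t) (t !)) ⟩
    d (suc (suc t)) ℤ.* (+ suc t ℤ.* + (t !)) ℤ.+ + m ℤ.* (d (suc t) ℤ.* + (t !))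
      ≡⟨ pull (+ suc t) (+ (t !)) (d (suc (suc t))) (+ m) (d (suc t)) ⟩
    d′ (suc t) ℤ.* + (t !)
      ∎
    where
    m = suc n + suc t
    pull : ∀ a f x m y → x ℤ.* (a ℤ.* f) ℤ.+ m ℤ.* (y ℤ.* f) ≡ (a ℤ.* x ℤ.+ m ℤ.* y) ℤ.* f
    pull = solve-∀
  factor : ∀ f m b a a′ → f ℤ.* (m ℤ.* b ℤ.- (+ 0 ℤ.* a′ ℤ.+ m ℤ.* a)) ≡ (m ℤ.* f) ℤ.* (b ℤ.- a)
  factor = solve-∀

signedFactorial : ℕ → ℤ
signedFactorial t = (- + 2) ℤ.^ t ℤ.* + ((t ∸ 1) !)

term≡weight : ∀ {n} (w : SetPartition n) → term w ≡ weight signedFactorial (sizes w)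
term≡weight w
  rewrite length-map length w | sym (map-∘ {g = _!} {f = length} w) =
  swap ((- + 2) ℤ.^ length w) (+ product (map (λ b → length b !) w)) (+ ((length w ∸ 1) !))
  where
  swap : ∀ a b q → a ℤ.* b ℤ.* q ≡ a ℤ.* q ℤ.* b
  swap = solve-∀

g-suc : ∀ m → g (suc m) ≡ + (m !) ℤ.* (ℤ.-1ℤ ℤ.^ suc m ℤ.- + 1)
g-suc m = begin
  sumℤ (map term (Part (suc m)))
    ≡⟨ cong sumℤ (trans (map-cong term≡weight (Part (suc m))) (map-∘ (Part (suc m)))) ⟩
  sumℤ (map (weight signedFactorial) (blockSizes (suc m)))
    ≡⟨ sumℤ-weight-blockSizes (suc m) signedFactorial ⟩
  lahSum (suc m) signedFactorial
    ≡⟨ lahSum-binomialSum m ((- + 2) ℤ.^_) signedFactorial (λ _ → refl) ⟩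
  + (m !) ℤ.* (binomialSum (suc m) ((- + 2) ℤ.^_) ℤ.- + 1)
    ≡⟨ cong (λ i → + (m !) ℤ.* (i ℤ.- + 1)) (binomialSum-pow (suc m) (- + 2)) ⟩
  + (m !) ℤ.* (ℤ.-1ℤ ℤ.^ suc m ℤ.- + 1)
    ∎
  where open ≡-Reasoning

-1ℤ^2k≡1ℤ : ∀ k → ℤ.-1ℤ ℤ.^ (2 * k) ≡ ℤ.1ℤ
-1ℤ^2k≡1ℤ k = trans (sym (^-*-assoc ℤ.-1ℤ 2 k)) (^-zeroˡ k)

g-odd : ∀ k → g (suc (2 * k)) ≡ - (+ (2 * ((2 * k) !)))
g-odd k = begin
  g (suc (2 * k))
    ≡⟨ g-suc (2 * k) ⟩
  + ((2 * k) !) ℤ.* (ℤ.-1ℤ ℤ.* ℤ.-1ℤ ℤ.^ (2 * k) ℤ.- + 1)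
    ≡⟨ cong (λ i → + ((2 * k) !) ℤ.* (ℤ.-1ℤ ℤ.* i ℤ.- + 1)) (-1ℤ^2k≡1ℤ k) ⟩
  + ((2 * k) !) ℤ.* - + 2
    ≡⟨ *-comm (+ ((2 * k) !)) (- + 2) ⟩
  - + 2 ℤ.* + ((2 * k) !)
    ≡⟨ neg-distribˡ-* (+ 2) (+ ((2 * k) !)) ⟨
  - (+ 2 ℤ.* + ((2 * k) !))
    ≡⟨ cong -_ (pos-* 2 ((2 * k) !)) ⟨
  - (+ (2 * ((2 * k) !)))
    ∎
  where open ≡-Reasoning

g-even : ∀ k → g (suc (suc (2 * k))) ≡ + 0
g-even k = begin
  g (suc (suc (2 * k)))
    ≡⟨ g-suc (suc (2 * k)) ⟩
  + (suc (2 * k) !) ℤ.* (ℤ.-1ℤ ℤ.* (ℤ.-1ℤ ℤ.* ℤ.-1ℤ ℤ.^ (2 * k)) ℤ.- + 1)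
    ≡⟨ cong (λ i → + (suc (2 * k) !) ℤ.* (ℤ.-1ℤ ℤ.* (ℤ.-1ℤ ℤ.* i) ℤ.- + 1)) (-1ℤ^2k≡1ℤ k) ⟩
  + (suc (2 * k) !) ℤ.* + 0
    ≡⟨ *-zeroʳ (+ (suc (2 * k) !)) ⟩
  + 0
    ∎
  where open ≡-Reasoning

mainTheorem5 : (k : ℕ) →
    (g (suc (2 * k)) ≡ - (+ (2 * ((2 * k) !))))
    × (g (2 * k + 2) ≡ + 0)
mainTheorem5 k = g-odd k , subst (λ m → g m ≡ + 0) (ℕ.+-comm 2 (2 * k)) (g-even k)
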